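{- For all integers $n,r\ge1$, $$ \sum_{\ell=1}^{n} \ell H_{\ell}^{(r)}=\frac{n(n+r)}{r+1}H_n^{(r)}-\frac{(n-1)^{(r+1)}}{(r-1)!(r+1)^2} =\frac{n r}{r+1}H_n^{(r+1)}+\frac{1}{r+1}\binom{n+r}{r+1}\,. $$
   Context: $H_n=\sum_{j=1}^n\frac1j$; the hyperharmonic numbers are $H_n^{(1)}=H_n$ and $H_n^{(r)}=\sum_{\ell=1}^n H_\ell^{(r-1)}$ for $r\ge2$. $(x)^{(m)}=x(x+1)\cdots(x+m-1)$ denotes the rising factorial, $(x)^{(0)}=1$. -}

module Defs where

open import Data.Nat as ℕ using (ℕ; zero; suc)
open import Data.Integer using (+_)
open import Data.Rational using (ℚ; 0ℚ; _+_; _*_; _/_)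

ℕ→ℚ : ℕ → ℚ
ℕ→ℚ n = (+ n) / 1

_/ℕ_ : ℚ → (d : ℕ) → .{{_ : ℕ.NonZero d}} → ℚ
q /ℕ d = q * ((+ 1) / d)

Σ₁ : ℕ → (ℕ → ℚ) → ℚ
Σ₁ zero    f = 0ℚ
Σ₁ (suc n) f = Σ₁ n f + f (suc n)

H : ℕ → ℚ
H n = Σ₁ n (λ j → (+ 1) / suc (ℕ.pred j))

-- hyperharmonic numbers H_n^{(r)} for r ≥ 1: hyp n r = H_n^{(r)}
-- (hyp n 0 = H_n^{(1)} is not used; the index r=0 is mapped to H_n.)
hyp : ℕ → ℕ → ℚ
hyp n zero          = H n
hyp n (suc zero)    = H n
hyp n (suc (suc r)) = Σ₁ n (λ ℓ → hyp ℓ (suc r))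

rising : ℕ → ℕ → ℕ
rising x zero    = 1
rising x (suc m) = rising x m ℕ.* (x ℕ.+ m)

open import Data.Nat.Properties using (_!≢0)
_/!_ : ℚ → ℕ → ℚ
q /! k = _/ℕ_ q (k ℕ.!) {{k !≢0}}

-- Everything follows from the weighted recurrence
--   (n+1) H_{n+1}^{(r)} = r H_n^{(r+1)} + C(n+r, r),
-- proved by induction on r and n from H_{n+1}^{(r+1)} = H_n^{(r+1)} + H_{n+1}^{(r)} and Pascal's
-- rule. Summing it gives (r+1) Σ_{ℓ≤n} ℓ H_ℓ^{(r)} = n r H_n^{(r+1)} + C(n+r, r+1), the second
-- form. Using the recurrence once more, n r H_n^{(r+1)} = n(n+r) H_n^{(r)} - n C(n+r-1, r), and
-- (r+1) C(n+r, r+1) = (n+r) C(n+r-1, r) together with (n-1)^{(r+1)} = (r-1)! (n-1) r C(n+r-1, r)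
-- turn the second form into the first.
module Submission where

open import Defs
open import Data.Nat as ℕ using (ℕ; suc; _≥_)
open import Data.Nat.Combinatorics using (_C_)
open import Data.Rational using (ℚ; _+_; _-_; _*_)
open import Data.Product using (_×_)
open import Relation.Binary.PropositionalEquality using (_≡_)

open import Data.Integer as ℤ using (+_)
import Data.Integer.Properties as ℤ
open import Data.Integer.Tactic.RingSolver renaming (solve-∀ to ℤ-solve-∀)
open import Data.Nat using (zero; _!)
open import Data.Nat.Combinatorics using (nC1≡n; nCn≡1; nCk+nC[k+1]≡[n+1]C[k+1])
open import Data.Nat.Combinatorics.Specification using (k>n⇒nCk≡0)
open import Data.Nat.Coprimality as Coprime using (1-coprimeTo)
import Data.Nat.Properties as ℕ
open import Data.Nat.Tactic.RingSolver renaming (solve-∀ to ℕ-solve-∀)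
open import Data.Product using (_,_)
open import Data.Rational using (0ℚ; 1ℚ; _/_; mkℚ; toℚᵘ)
open import Data.Rational.Properties
  using ( _≟_; +-*-commutativeRing; toℚᵘ-injective; toℚᵘ-fromℚᵘ; toℚᵘ-homo-+; toℚᵘ-homo-*
        ; normalize-coprime; *-inverseʳ; +-identityˡ; *-identityˡ; *-identityʳ; *-zeroˡ; *-zeroʳ
        ; *-assoc; *-comm; *-distribˡ-+ )
import Data.Rational.Unnormalised as ℚᵘ
import Data.Rational.Unnormalised.Properties as ℚᵘ
open import Level using (0ℓ)
open import Relation.Binary.PropositionalEquality using (refl; sym; trans; cong; cong₂; module ≡-Reasoning)
open import Relation.Nullary.Decidable using (dec⇒maybe)
open import Tactic.RingSolver using (solve-∀)
open import Tactic.RingSolver.Core.AlmostCommutativeRing using (AlmostCommutativeRing; fromCommutativeRing)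

ℚ-ring : AlmostCommutativeRing 0ℓ 0ℓ
ℚ-ring = fromCommutativeRing +-*-commutativeRing (λ x → dec⇒maybe (0ℚ ≟ x))

toℚᵘ-ℕ→ℚ : ∀ n → toℚᵘ (ℕ→ℚ n) ℚᵘ.≃ ℚᵘ.mkℚᵘ (+ n) 0
toℚᵘ-ℕ→ℚ n = toℚᵘ-fromℚᵘ (ℚᵘ.mkℚᵘ (+ n) 0)

ℕ→ℚ-+ : ∀ m n → ℕ→ℚ (m ℕ.+ n) ≡ ℕ→ℚ m + ℕ→ℚ n
ℕ→ℚ-+ m n = toℚᵘ-injective (begin
    toℚᵘ (ℕ→ℚ (m ℕ.+ n))                  ≈⟨ toℚᵘ-ℕ→ℚ (m ℕ.+ n) ⟩
    ℚᵘ.mkℚᵘ (+ m ℤ.+ + n) 0               ≈⟨ ℚᵘ.*≡* (numerators (+ m) (+ n)) ⟩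
    ℚᵘ.mkℚᵘ (+ m) 0 ℚᵘ.+ ℚᵘ.mkℚᵘ (+ n) 0  ≈⟨ ℚᵘ.+-cong (toℚᵘ-ℕ→ℚ m) (toℚᵘ-ℕ→ℚ n) ⟨
    toℚᵘ (ℕ→ℚ m) ℚᵘ.+ toℚᵘ (ℕ→ℚ n)        ≈⟨ toℚᵘ-homo-+ (ℕ→ℚ m) (ℕ→ℚ n) ⟨
    toℚᵘ (ℕ→ℚ m + ℕ→ℚ n)                  ∎)
  where
  open ℚᵘ.≃-Reasoning
  numerators : ∀ x y → (x ℤ.+ y) ℤ.* (+ 1 ℤ.* + 1) ≡ (x ℤ.* + 1 ℤ.+ y ℤ.* + 1) ℤ.* + 1
  numerators = ℤ-solve-∀

ℕ→ℚ-* : ∀ m n → ℕ→ℚ (m ℕ.* n) ≡ ℕ→ℚ m * ℕ→ℚ n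
ℕ→ℚ-* m n = toℚᵘ-injective (begin
    toℚᵘ (ℕ→ℚ (m ℕ.* n))                  ≈⟨ toℚᵘ-ℕ→ℚ (m ℕ.* n) ⟩
    ℚᵘ.mkℚᵘ (+ (m ℕ.* n)) 0               ≈⟨ ℚᵘ.*≡* (trans (cong (ℤ._* + 1) (ℤ.pos-* m n)) (numerators (+ m) (+ n))) ⟩
    ℚᵘ.mkℚᵘ (+ m) 0 ℚᵘ.* ℚᵘ.mkℚᵘ (+ n) 0  ≈⟨ ℚᵘ.*-cong (toℚᵘ-ℕ→ℚ m) (toℚᵘ-ℕ→ℚ n) ⟨
    toℚᵘ (ℕ→ℚ m) ℚᵘ.* toℚᵘ (ℕ→ℚ n)        ≈⟨ toℚᵘ-homo-* (ℕ→ℚ m) (ℕ→ℚ n) ⟨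
    toℚᵘ (ℕ→ℚ m * ℕ→ℚ n)                  ∎)
  where
  open ℚᵘ.≃-Reasoning
  numerators : ∀ x y → (x ℤ.* y) ℤ.* (+ 1 ℤ.* + 1) ≡ (x ℤ.* y) ℤ.* + 1
  numerators = ℤ-solve-∀

ℕ→ℚ-suc : ∀ n → ℕ→ℚ (suc n) ≡ 1ℚ + ℕ→ℚ n
ℕ→ℚ-suc = ℕ→ℚ-+ 1

ℕ→ℚ-*-inverseʳ : ∀ d .{{_ : ℕ.NonZero d}} → ℕ→ℚ d * ((+ 1) / d) ≡ 1ℚ
ℕ→ℚ-*-inverseʳ (suc k) =
  trans (cong₂ _*_ (normalize-coprime d⊥1) (normalize-coprime (1-coprimeTo (suc k))))
        (*-inverseʳ (mkℚ (+ suc k) 0 d⊥1))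
  where
  d⊥1 : Coprime.Coprime (suc k) 1
  d⊥1 = Coprime.sym (1-coprimeTo (suc k))

*-cancelˡ-/ℕ : ∀ d q .{{_ : ℕ.NonZero d}} → (ℕ→ℚ d * q) /ℕ d ≡ q
*-cancelˡ-/ℕ d q = begin
  (ℕ→ℚ d * q) * ((+ 1) / d)  ≡⟨ cong (_* ((+ 1) / d)) (*-comm (ℕ→ℚ d) q) ⟩
  (q * ℕ→ℚ d) * ((+ 1) / d)  ≡⟨ *-assoc q (ℕ→ℚ d) ((+ 1) / d) ⟩
  q * (ℕ→ℚ d * ((+ 1) / d))  ≡⟨ cong (q *_) (ℕ→ℚ-*-inverseʳ d) ⟩
  q * 1ℚ                     ≡⟨ *-identityʳ q ⟩
  q                          ∎
  where open ≡-Reasoning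

[k+1]*[n+1]C[k+1]≡[n+1]*nCk : ∀ n k → suc k ℕ.* (suc n C suc k) ≡ suc n ℕ.* (n C k)
[k+1]*[n+1]C[k+1]≡[n+1]*nCk n zero =
  trans (ℕ.+-identityʳ (suc n C 1)) (trans (nC1≡n (suc n)) (sym (ℕ.*-identityʳ (suc n))))
[k+1]*[n+1]C[k+1]≡[n+1]*nCk zero (suc k) = ℕ.*-zeroʳ (suc (suc k))
[k+1]*[n+1]C[k+1]≡[n+1]*nCk (suc n) (suc k) = begin
  suc (suc k) ℕ.* (suc (suc n) C suc (suc k))        ≡⟨ cong (suc (suc k) ℕ.*_) (sym (nCk+nC[k+1]≡[n+1]C[k+1] (suc n) (suc k))) ⟩
  suc (suc k) ℕ.* (A ℕ.+ B)                          ≡⟨ regroup k A B ⟩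
  A ℕ.+ suc k ℕ.* A ℕ.+ suc (suc k) ℕ.* B            ≡⟨ cong₂ (λ u v → A ℕ.+ u ℕ.+ v)
                                                          ([k+1]*[n+1]C[k+1]≡[n+1]*nCk n k)
                                                          ([k+1]*[n+1]C[k+1]≡[n+1]*nCk n (suc k)) ⟩
  A ℕ.+ suc n ℕ.* (n C k) ℕ.+ suc n ℕ.* (n C suc k)  ≡⟨ factor n A (n C k) (n C suc k) ⟩
  A ℕ.+ suc n ℕ.* (n C k ℕ.+ n C suc k)              ≡⟨ cong (λ u → A ℕ.+ suc n ℕ.* u) (nCk+nC[k+1]≡[n+1]C[k+1] n k) ⟩
  suc (suc n) ℕ.* A                                  ∎
  where
  open ≡-Reasoning
  A = suc n C suc k
  B = suc n C suc (suc k)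
  regroup : ∀ k a b → (2 ℕ.+ k) ℕ.* (a ℕ.+ b) ≡ a ℕ.+ (1 ℕ.+ k) ℕ.* a ℕ.+ (2 ℕ.+ k) ℕ.* b
  regroup = ℕ-solve-∀
  factor : ∀ n a x y → a ℕ.+ (1 ℕ.+ n) ℕ.* x ℕ.+ (1 ℕ.+ n) ℕ.* y ≡ a ℕ.+ (1 ℕ.+ n) ℕ.* (x ℕ.+ y)
  factor = ℕ-solve-∀

rising[x,1+k]≡x*rising[1+x,k] : ∀ x k → rising x (suc k) ≡ x ℕ.* rising (suc x) k
rising[x,1+k]≡x*rising[1+x,k] x zero = base x
  where
  base : ∀ x → 1 ℕ.* (x ℕ.+ 0) ≡ x ℕ.* 1
  base = ℕ-solve-∀
rising[x,1+k]≡x*rising[1+x,k] x (suc k) =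
  trans (cong (ℕ._* (x ℕ.+ suc k)) (rising[x,1+k]≡x*rising[1+x,k] x k)) (step x (rising (suc x) k) k)
  where
  step : ∀ x ρ k → x ℕ.* ρ ℕ.* (x ℕ.+ (1 ℕ.+ k)) ≡ x ℕ.* (ρ ℕ.* (1 ℕ.+ x ℕ.+ k))
  step = ℕ-solve-∀

rising[1+m,k]≡k!*[m+k]Ck : ∀ m k → rising (suc m) k ≡ k ! ℕ.* ((m ℕ.+ k) C k)
rising[1+m,k]≡k!*[m+k]Ck m zero = refl
rising[1+m,k]≡k!*[m+k]Ck m (suc k) = begin
  rising (suc m) k ℕ.* suc (m ℕ.+ k)                ≡⟨ cong (ℕ._* suc (m ℕ.+ k)) (rising[1+m,k]≡k!*[m+k]Ck m k) ⟩
  k ! ℕ.* ((m ℕ.+ k) C k) ℕ.* suc (m ℕ.+ k)         ≡⟨ regroup (k !) ((m ℕ.+ k) C k) (suc (m ℕ.+ k)) ⟩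
  k ! ℕ.* (suc (m ℕ.+ k) ℕ.* ((m ℕ.+ k) C k))       ≡⟨ cong (k ! ℕ.*_) (sym ([k+1]*[n+1]C[k+1]≡[n+1]*nCk (m ℕ.+ k) k)) ⟩
  k ! ℕ.* (suc k ℕ.* (suc (m ℕ.+ k) C suc k))       ≡⟨ regroup′ (k !) (suc k) (suc (m ℕ.+ k) C suc k) ⟩
  suc k ! ℕ.* (suc (m ℕ.+ k) C suc k)               ≡⟨ cong (λ u → suc k ! ℕ.* (u C suc k)) (sym (ℕ.+-suc m k)) ⟩
  suc k ! ℕ.* ((m ℕ.+ suc k) C suc k)               ∎
  where
  open ≡-Reasoning
  regroup : ∀ f c s → f ℕ.* c ℕ.* s ≡ f ℕ.* (s ℕ.* c)
  regroup = ℕ-solve-∀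
  regroup′ : ∀ f s c → f ℕ.* (s ℕ.* c) ≡ s ℕ.* f ℕ.* c
  regroup′ = ℕ-solve-∀

[1+r]*[1+m+r]C[1+r]+m*r*c≡[1+r]*[1+m]*c : ∀ m r →
  suc r ℕ.* ((suc m ℕ.+ r) C suc r) ℕ.+ m ℕ.* r ℕ.* ((m ℕ.+ r) C r) ≡ suc r ℕ.* (suc m ℕ.* ((m ℕ.+ r) C r))
[1+r]*[1+m+r]C[1+r]+m*r*c≡[1+r]*[1+m]*c m r =
  trans (cong (ℕ._+ m ℕ.* r ℕ.* ((m ℕ.+ r) C r)) ([k+1]*[n+1]C[k+1]≡[n+1]*nCk (m ℕ.+ r) r))
        (regroup m r ((m ℕ.+ r) C r))
  where
  regroup : ∀ m r c → (1 ℕ.+ (m ℕ.+ r)) ℕ.* c ℕ.+ m ℕ.* r ℕ.* c ≡ (1 ℕ.+ r) ℕ.* ((1 ℕ.+ m) ℕ.* c)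
  regroup = ℕ-solve-∀

rising[m,2+r]≡r!*m*[1+r]*C : ∀ m r → rising m (2 ℕ.+ r) ≡ r ! ℕ.* (m ℕ.* suc r ℕ.* ((m ℕ.+ suc r) C suc r))
rising[m,2+r]≡r!*m*[1+r]*C m r =
  trans (rising[x,1+k]≡x*rising[1+x,k] m (suc r))
        (trans (cong (m ℕ.*_) (rising[1+m,k]≡k!*[m+k]Ck m (suc r))) (regroup m (suc r) (r !) ((m ℕ.+ suc r) C suc r)))
  where
  regroup : ∀ m s f c → m ℕ.* (s ℕ.* f ℕ.* c) ≡ f ℕ.* (m ℕ.* s ℕ.* c)
  regroup = ℕ-solve-∀

hyp-one : ∀ r → hyp 1 r ≡ 1ℚ
hyp-one zero          = +-identityˡ 1ℚ
hyp-one (suc zero)    = +-identityˡ 1ℚ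
hyp-one (suc (suc r)) = trans (+-identityˡ (hyp 1 (suc r))) (hyp-one (suc r))

[1+a]*[x+y] : ∀ a x y → (1ℚ + a) * (x + y) ≡ a * x + x + (1ℚ + a) * y
[1+a]*[x+y] = solve-∀ ℚ-ring

harmonic-order-step : ∀ n → ℕ→ℚ (suc n) * H (suc n) ≡ hyp n 2 + ℕ→ℚ (suc n)
harmonic-order-step zero    = refl
harmonic-order-step (suc n) = begin
  ℕ→ℚ (2 ℕ.+ n) * (X + i)       ≡⟨ cong (_* (X + i)) (ℕ→ℚ-suc (suc n)) ⟩
  (1ℚ + a) * (X + i)            ≡⟨ [1+a]*[x+y] a X i ⟩
  a * X + X + (1ℚ + a) * i      ≡⟨ cong₂ (λ u v → u + X + v) (harmonic-order-step n) a+1*i≡1 ⟩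
  hyp n 2 + a + X + 1ℚ          ≡⟨ regroup (hyp n 2) a X ⟩
  hyp n 2 + X + (1ℚ + a)        ≡⟨ cong (λ u → hyp n 2 + X + u) (sym (ℕ→ℚ-suc (suc n))) ⟩
  hyp n 2 + X + ℕ→ℚ (2 ℕ.+ n)   ∎
  where
  open ≡-Reasoning
  a = ℕ→ℚ (suc n)
  X = H (suc n)
  i = (+ 1) / (2 ℕ.+ n)
  a+1*i≡1 : (1ℚ + a) * i ≡ 1ℚ
  a+1*i≡1 = trans (cong (_* i) (sym (ℕ→ℚ-suc (suc n)))) (ℕ→ℚ-*-inverseʳ (2 ℕ.+ n))
  regroup : ∀ p a x → p + a + x + 1ℚ ≡ p + x + (1ℚ + a)
  regroup = solve-∀ ℚ-ring

hyp-order-step : ∀ r n → ℕ→ℚ (suc n) * hyp (suc n) (suc r)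
                         ≡ ℕ→ℚ (suc r) * hyp n (suc (suc r)) + ℕ→ℚ ((n ℕ.+ suc r) C suc r)
hyp-order-step zero n = begin
  ℕ→ℚ (suc n) * H (suc n)                 ≡⟨ harmonic-order-step n ⟩
  hyp n 2 + ℕ→ℚ (suc n)                   ≡⟨ cong₂ _+_ (sym (*-identityˡ (hyp n 2))) (cong ℕ→ℚ (sym n+1C1≡1+n)) ⟩
  1ℚ * hyp n 2 + ℕ→ℚ ((n ℕ.+ 1) C 1)      ∎
  where
  open ≡-Reasoning
  n+1C1≡1+n : (n ℕ.+ 1) C 1 ≡ suc n
  n+1C1≡1+n = trans (nC1≡n (n ℕ.+ 1)) (ℕ.+-comm n 1)
hyp-order-step (suc r) zero = begin
  1ℚ * hyp 1 (2 ℕ.+ r)                            ≡⟨ trans (*-identityˡ _) (hyp-one (2 ℕ.+ r)) ⟩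
  1ℚ                                              ≡⟨ sym (+-identityˡ 1ℚ) ⟩
  0ℚ + 1ℚ                                         ≡⟨ cong₂ _+_ (sym (*-zeroʳ (ℕ→ℚ (2 ℕ.+ r)))) (cong ℕ→ℚ (sym (nCn≡1 (2 ℕ.+ r)))) ⟩
  ℕ→ℚ (2 ℕ.+ r) * 0ℚ + ℕ→ℚ ((2 ℕ.+ r) C (2 ℕ.+ r)) ∎
  where open ≡-Reasoning
hyp-order-step (suc r) (suc n) = begin
  ℕ→ℚ (2 ℕ.+ n) * (A + D)                  ≡⟨ cong (_* (A + D)) (ℕ→ℚ-suc (suc n)) ⟩
  (1ℚ + ℕ→ℚ (suc n)) * (A + D)             ≡⟨ [1+a]*[x+y] (ℕ→ℚ (suc n)) A D ⟩
  ℕ→ℚ (suc n) * A + A + (1ℚ + ℕ→ℚ (suc n)) * D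
    ≡⟨ cong₂ (λ u v → u + A + v) (hyp-order-step (suc r) n)
             (trans (cong (_* D) (sym (ℕ→ℚ-suc (suc n)))) (hyp-order-step r (suc n))) ⟩
  (ℕ→ℚ (2 ℕ.+ r) * B + c₁) + A + (ℕ→ℚ (suc r) * A + c₂)
    ≡⟨ cong (λ u → (u * B + c₁) + A + (ℕ→ℚ (suc r) * A + c₂)) (ℕ→ℚ-suc (suc r)) ⟩
  ((1ℚ + ℕ→ℚ (suc r)) * B + c₁) + A + (ℕ→ℚ (suc r) * A + c₂)
    ≡⟨ regroup (ℕ→ℚ (suc r)) A B c₁ c₂ ⟩
  (1ℚ + ℕ→ℚ (suc r)) * (B + A) + (c₂ + c₁)
    ≡⟨ cong₂ (λ u v → u * (B + A) + v) (sym (ℕ→ℚ-suc (suc r))) (sym pascal) ⟩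
  ℕ→ℚ (2 ℕ.+ r) * (B + A) + ℕ→ℚ ((suc n ℕ.+ (2 ℕ.+ r)) C (2 ℕ.+ r)) ∎
  where
  open ≡-Reasoning
  A = hyp (suc n) (2 ℕ.+ r)
  B = hyp n (3 ℕ.+ r)
  D = hyp (2 ℕ.+ n) (suc r)
  c₁ = ℕ→ℚ ((n ℕ.+ (2 ℕ.+ r)) C (2 ℕ.+ r))
  c₂ = ℕ→ℚ ((suc n ℕ.+ suc r) C suc r)
  regroup : ∀ p a b c₁ c₂ → ((1ℚ + p) * b + c₁) + a + (p * a + c₂) ≡ (1ℚ + p) * (b + a) + (c₂ + c₁)
  regroup = solve-∀ ℚ-ring
  pascal : ℕ→ℚ ((suc n ℕ.+ (2 ℕ.+ r)) C (2 ℕ.+ r)) ≡ c₂ + c₁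
  pascal = begin
    ℕ→ℚ (suc (n ℕ.+ (2 ℕ.+ r)) C (2 ℕ.+ r))
      ≡⟨ cong ℕ→ℚ (sym (nCk+nC[k+1]≡[n+1]C[k+1] (n ℕ.+ (2 ℕ.+ r)) (suc r))) ⟩
    ℕ→ℚ ((n ℕ.+ (2 ℕ.+ r)) C suc r ℕ.+ (n ℕ.+ (2 ℕ.+ r)) C (2 ℕ.+ r))
      ≡⟨ ℕ→ℚ-+ ((n ℕ.+ (2 ℕ.+ r)) C suc r) _ ⟩
    ℕ→ℚ ((n ℕ.+ (2 ℕ.+ r)) C suc r) + c₁
      ≡⟨ cong (λ u → ℕ→ℚ (u C suc r) + c₁) (ℕ.+-suc n (suc r)) ⟩
    c₂ + c₁ ∎

weighted-hyp-sum : ∀ r n → ℕ→ℚ (2 ℕ.+ r) * Σ₁ n (λ ℓ → ℕ→ℚ ℓ * hyp ℓ (suc r))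
                           ≡ ℕ→ℚ (n ℕ.* suc r) * hyp n (2 ℕ.+ r) + ℕ→ℚ ((n ℕ.+ suc r) C (2 ℕ.+ r))
weighted-hyp-sum r zero = begin
  ℕ→ℚ (2 ℕ.+ r) * 0ℚ                                  ≡⟨ *-zeroʳ (ℕ→ℚ (2 ℕ.+ r)) ⟩
  0ℚ                                                  ≡⟨ cong₂ _+_ (sym (*-zeroˡ (hyp 0 (2 ℕ.+ r)))) (cong ℕ→ℚ (sym (k>n⇒nCk≡0 (ℕ.n<1+n (suc r))))) ⟩
  0ℚ * hyp 0 (2 ℕ.+ r) + ℕ→ℚ (suc r C (2 ℕ.+ r))      ∎
  where open ≡-Reasoning
weighted-hyp-sum r (suc n) = begin
  ℕ→ℚ (2 ℕ.+ r) * (S + ℕ→ℚ (suc n) * h)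
    ≡⟨ cong₂ (λ u v → u * (S + v * h)) (ℕ→ℚ-suc (suc r)) (ℕ→ℚ-suc n) ⟩
  (1ℚ + ρ) * (S + (1ℚ + a) * h)
    ≡⟨ *-distribˡ-+ (1ℚ + ρ) S ((1ℚ + a) * h) ⟩
  (1ℚ + ρ) * S + (1ℚ + ρ) * ((1ℚ + a) * h)
    ≡⟨ cong₂ _+_ sum-step (cong ((1ℚ + ρ) *_) order-step) ⟩
  (a * ρ * H′ + c₂) + (1ℚ + ρ) * (ρ * H′ + c₁)
    ≡⟨ regroup a ρ H′ c₁ c₂ ⟩
  (1ℚ + a) * ρ * H′ + ρ * (ρ * H′ + c₁) + (c₁ + c₂)
    ≡⟨ cong (λ u → (1ℚ + a) * ρ * H′ + ρ * u + (c₁ + c₂)) (sym order-step) ⟩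
  (1ℚ + a) * ρ * H′ + ρ * ((1ℚ + a) * h) + (c₁ + c₂)
    ≡⟨ regroup′ a ρ H′ h (c₁ + c₂) ⟩
  (1ℚ + a) * ρ * (H′ + h) + (c₁ + c₂)
    ≡⟨ cong₂ (λ u v → u * (H′ + h) + v) (sym (trans (ℕ→ℚ-* (suc n) (suc r)) (cong (_* ρ) (ℕ→ℚ-suc n)))) (sym pascal) ⟩
  ℕ→ℚ (suc n ℕ.* suc r) * (H′ + h) + ℕ→ℚ ((suc n ℕ.+ suc r) C (2 ℕ.+ r)) ∎
  where
  open ≡-Reasoning
  a  = ℕ→ℚ n
  ρ  = ℕ→ℚ (suc r)
  S  = Σ₁ n (λ ℓ → ℕ→ℚ ℓ * hyp ℓ (suc r))
  h  = hyp (suc n) (suc r)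
  H′ = hyp n (2 ℕ.+ r)
  c₁ = ℕ→ℚ ((n ℕ.+ suc r) C suc r)
  c₂ = ℕ→ℚ ((n ℕ.+ suc r) C (2 ℕ.+ r))
  sum-step : (1ℚ + ρ) * S ≡ a * ρ * H′ + c₂
  sum-step = trans (cong (_* S) (sym (ℕ→ℚ-suc (suc r))))
                   (trans (weighted-hyp-sum r n) (cong (λ u → u * H′ + c₂) (ℕ→ℚ-* n (suc r))))
  order-step : (1ℚ + a) * h ≡ ρ * H′ + c₁
  order-step = trans (cong (_* h) (sym (ℕ→ℚ-suc n))) (hyp-order-step r n)
  pascal : ℕ→ℚ ((suc n ℕ.+ suc r) C (2 ℕ.+ r)) ≡ c₁ + c₂
  pascal = trans (cong ℕ→ℚ (sym (nCk+nC[k+1]≡[n+1]C[k+1] (n ℕ.+ suc r) (suc r))))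
                 (ℕ→ℚ-+ ((n ℕ.+ suc r) C suc r) _)
  regroup : ∀ a ρ x c₁ c₂ → (a * ρ * x + c₂) + (1ℚ + ρ) * (ρ * x + c₁)
                            ≡ (1ℚ + a) * ρ * x + ρ * (ρ * x + c₁) + (c₁ + c₂)
  regroup = solve-∀ ℚ-ring
  regroup′ : ∀ a ρ x y c → (1ℚ + a) * ρ * x + ρ * ((1ℚ + a) * y) + c ≡ (1ℚ + a) * ρ * (x + y) + c
  regroup′ = solve-∀ ℚ-ring

hyp-raise-order : ∀ r m →
  ℕ→ℚ (suc m ℕ.* suc r) * hyp (suc m) (2 ℕ.+ r) + ℕ→ℚ (suc m ℕ.* ((m ℕ.+ suc r) C suc r))
  ≡ ℕ→ℚ (suc m ℕ.* (suc m ℕ.+ suc r)) * hyp (suc m) (suc r)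
hyp-raise-order r m = begin
  ℕ→ℚ (suc m ℕ.* suc r) * (H′ + h) + ℕ→ℚ (suc m ℕ.* ((m ℕ.+ suc r) C suc r))
    ≡⟨ cong₂ (λ u v → u * (H′ + h) + v) (ℕ→ℚ-* (suc m) (suc r)) (ℕ→ℚ-* (suc m) ((m ℕ.+ suc r) C suc r)) ⟩
  n * ρ * (H′ + h) + n * c
    ≡⟨ regroup n ρ H′ h c ⟩
  n * (ρ * H′ + c) + n * ρ * h
    ≡⟨ cong (λ u → n * u + n * ρ * h) (sym (hyp-order-step r m)) ⟩
  n * (n * h) + n * ρ * h
    ≡⟨ regroup′ n ρ h ⟩
  n * (n + ρ) * h
    ≡⟨ cong (_* h) (sym (trans (ℕ→ℚ-* (suc m) (suc m ℕ.+ suc r)) (cong (n *_) (ℕ→ℚ-+ (suc m) (suc r))))) ⟩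
  ℕ→ℚ (suc m ℕ.* (suc m ℕ.+ suc r)) * h ∎
  where
  open ≡-Reasoning
  n  = ℕ→ℚ (suc m)
  ρ  = ℕ→ℚ (suc r)
  c  = ℕ→ℚ ((m ℕ.+ suc r) C suc r)
  h  = hyp (suc m) (suc r)
  H′ = hyp m (2 ℕ.+ r)
  regroup : ∀ n ρ x y c → n * ρ * (x + y) + n * c ≡ n * (ρ * x + c) + n * ρ * y
  regroup = solve-∀ ℚ-ring
  regroup′ : ∀ n ρ y → n * (n * y) + n * ρ * y ≡ n * (n + ρ) * y
  regroup′ = solve-∀ ℚ-ring

hyp-sum-second-form : ∀ r n → Σ₁ n (λ ℓ → ℕ→ℚ ℓ * hyp ℓ (suc r))
  ≡ (ℕ→ℚ (n ℕ.* suc r) /ℕ (2 ℕ.+ r)) * hyp n (2 ℕ.+ r) + ℕ→ℚ ((n ℕ.+ suc r) C (2 ℕ.+ r)) /ℕ (2 ℕ.+ r)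
hyp-sum-second-form r n = begin
  S                                  ≡⟨ sym (*-cancelˡ-/ℕ (2 ℕ.+ r) S) ⟩
  (ℕ→ℚ (2 ℕ.+ r) * S) /ℕ (2 ℕ.+ r)   ≡⟨ cong (λ q → q /ℕ (2 ℕ.+ r)) (weighted-hyp-sum r n) ⟩
  (a * H′ + c) /ℕ (2 ℕ.+ r)          ≡⟨ distrib a H′ c ((+ 1) / (2 ℕ.+ r)) ⟩
  (a /ℕ (2 ℕ.+ r)) * H′ + c /ℕ (2 ℕ.+ r) ∎
  where
  open ≡-Reasoning
  S  = Σ₁ n (λ ℓ → ℕ→ℚ ℓ * hyp ℓ (suc r))
  a  = ℕ→ℚ (n ℕ.* suc r)
  c  = ℕ→ℚ ((n ℕ.+ suc r) C (2 ℕ.+ r))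
  H′ = hyp n (2 ℕ.+ r)
  distrib : ∀ a x c i → (a * x + c) * i ≡ (a * i) * x + c * i
  distrib = solve-∀ ℚ-ring

hyp-sum-first-form : ∀ r m → Σ₁ (suc m) (λ ℓ → ℕ→ℚ ℓ * hyp ℓ (suc r))
  ≡ (ℕ→ℚ (suc m ℕ.* (suc m ℕ.+ suc r)) /ℕ (2 ℕ.+ r)) * hyp (suc m) (suc r)
    - ((ℕ→ℚ (rising m (2 ℕ.+ r)) /! r) /ℕ (2 ℕ.+ r)) /ℕ (2 ℕ.+ r)
hyp-sum-first-form r m = begin
  Σ₁ (suc m) (λ ℓ → ℕ→ℚ ℓ * hyp ℓ (suc r))  ≡⟨ hyp-sum-second-form r (suc m) ⟩
  (a * i) * Y + C′ * i                     ≡⟨ add-and-subtract-e a i Y C′ e ⟩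
  (a * Y + e) * i - (e - C′) * i * 1ℚ      ≡⟨ cong₂ (λ u v → u * i - (e - C′) * i * v) (hyp-raise-order r m) (sym (ℕ→ℚ-*-inverseʳ D)) ⟩
  (b * X) * i - (e - C′) * i * (δ * i)     ≡⟨ expand-δ*i b X i e C′ δ ⟩
  (b * i) * X - ((δ * e - δ * C′) * i) * i ≡⟨ cong (λ u → (b * i) * X - ((u - δ * C′) * i) * i) (sym binomial) ⟩
  (b * i) * X - ((δ * C′ + F - δ * C′) * i) * i ≡⟨ cancel-δ*C′ b X i δ C′ F ⟩
  (b * i) * X - (F * i) * i                ≡⟨ cong (λ u → (b * i) * X - (u * i) * i) (sym rising/r!) ⟩
  (b * i) * X - ((ℕ→ℚ (rising m D) /! r) * i) * i ∎
  where
  open ≡-Reasoning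
  D  = 2 ℕ.+ r
  c  = (m ℕ.+ suc r) C suc r
  f  = m ℕ.* suc r ℕ.* c
  δ  = ℕ→ℚ D
  i  = (+ 1) / D
  a  = ℕ→ℚ (suc m ℕ.* suc r)
  b  = ℕ→ℚ (suc m ℕ.* (suc m ℕ.+ suc r))
  e  = ℕ→ℚ (suc m ℕ.* c)
  F  = ℕ→ℚ f
  C′ = ℕ→ℚ ((suc m ℕ.+ suc r) C D)
  X  = hyp (suc m) (suc r)
  Y  = hyp (suc m) D
  rising/r! : ℕ→ℚ (rising m D) /! r ≡ F
  rising/r! = trans (cong (λ u → _/ℕ_ u (r !) {{r ℕ.!≢0}})
                          (trans (cong ℕ→ℚ (rising[m,2+r]≡r!*m*[1+r]*C m r)) (ℕ→ℚ-* (r !) f)))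
                    (*-cancelˡ-/ℕ (r !) F {{r ℕ.!≢0}})
  binomial : δ * C′ + F ≡ δ * e
  binomial = begin
    δ * C′ + F                                ≡⟨ cong (_+ F) (sym (ℕ→ℚ-* D ((suc m ℕ.+ suc r) C D))) ⟩
    ℕ→ℚ (D ℕ.* ((suc m ℕ.+ suc r) C D)) + F   ≡⟨ sym (ℕ→ℚ-+ (D ℕ.* ((suc m ℕ.+ suc r) C D)) f) ⟩
    ℕ→ℚ (D ℕ.* ((suc m ℕ.+ suc r) C D) ℕ.+ f) ≡⟨ cong ℕ→ℚ ([1+r]*[1+m+r]C[1+r]+m*r*c≡[1+r]*[1+m]*c m (suc r)) ⟩
    ℕ→ℚ (D ℕ.* (suc m ℕ.* c))                 ≡⟨ ℕ→ℚ-* D (suc m ℕ.* c) ⟩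
    δ * e                                     ∎
  add-and-subtract-e : ∀ a i y c e → (a * i) * y + c * i ≡ (a * y + e) * i - (e - c) * i * 1ℚ
  add-and-subtract-e = solve-∀ ℚ-ring
  expand-δ*i : ∀ b x i e c d → (b * x) * i - (e - c) * i * (d * i) ≡ (b * i) * x - ((d * e - d * c) * i) * i
  expand-δ*i = solve-∀ ℚ-ring
  cancel-δ*C′ : ∀ b x i d c f → (b * i) * x - ((d * c + f - d * c) * i) * i ≡ (b * i) * x - (f * i) * i
  cancel-δ*C′ = solve-∀ ℚ-ring

corollary1 : (n r : ℕ) → n ≥ 1 → r ≥ 1 →
  (Σ₁ n (λ ℓ → ℕ→ℚ ℓ * hyp ℓ r)
    ≡ (ℕ→ℚ (n ℕ.* (n ℕ.+ r)) /ℕ suc r) * hyp n r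
      - ((ℕ→ℚ (rising (ℕ.pred n) (suc r)) /! ℕ.pred r) /ℕ suc r) /ℕ suc r)
  × (Σ₁ n (λ ℓ → ℕ→ℚ ℓ * hyp ℓ r)
    ≡ (ℕ→ℚ (n ℕ.* r) /ℕ suc r) * hyp n (suc r)
      + ℕ→ℚ ((n ℕ.+ r) C (suc r)) /ℕ suc r)
corollary1 (suc m) (suc r) _ _ = hyp-sum-first-form r m , hyp-sum-second-form r (suc m)
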